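{- For a many-sorted finite model finding instance $P$, the set $\mathrm{DomSym}(P)^{\mathcal F}=\{\sigma^{\mathcal F}:\sigma\in\mathrm{DomSym}(P)\}$ is a subgroup of $\mathrm{SolSym}(P_{\mathrm{FCSP}})$.
   Context: MSFMF setting: a signature $\Sigma$ has finitely many sorts, function symbols $f:A_1\times\dots\times A_n\to B$ and predicate symbols $R:A_1\times\dots\times A_n\to\mathrm{Bool}$; a domain assignment $\mathcal U$ maps sorts to nonempty finite sets; $P=(\Sigma,\Gamma,\mathcal U)$ with $\Gamma$ a finite set of many-sorted first-order formulas with equality (domain values may appear as terms of their sort). An interpretation assigns to each $f$ a function $\mathcal U(A_1)\times\dots\times\mathcal U(A_n)\to\mathcal U(B)$ and to each $R$ a relation $\subseteq\mathcal U(A_1)\times\dots\times\mathcal U(A_n)$. A domain permutation $\sigma$ is a family of permutations $\sigma_\theta$ of $\mathcal U(\theta)$; it acts by $(\sigma\bullet I)(f)(\sigma_{A_1}(a_1),\dots,\sigma_{A_n}(a_n))=\sigma_B(I(f)(a_1,\dots,a_n))$ and $(a_1,\dots,a_n)\in I(R)\iff(\sigma_{A_1}(a_1),\dots,\sigma_{A_n}(a_n))\in(\sigma\bullet I)(R)$. $\mathrm{DomSym}(P)$ is the set of domain permutations $\sigma$ such that for all interpretations $I$, $\sigma\bullet I\models\Gamma$ iff $I\models\Gamma$. CSP setting: a CSP $(X,D,C)$ has finite variable set $X$, each $x$ with nonempty finite domain $D(x)$, and finitely many constraints, each a scope (sequence of variables) with a relation of allowed tuples. Bindings are pairs $(x,v)$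 with $v\in D(x)$; $\mathrm{Bindings}$ is their set. A complete assignment contains exactly one binding per variable; a solution is a complete assignment satisfying all constraints. A permutation $\pi$ of $\mathrm{Bindings}$ acts on sets of bindings pointwise, $\pi\bullet Z=\{\pi(b):b\in Z\}$. $\mathrm{SolSym}$ of a CSP is the set of permutations $\pi$ of $\mathrm{Bindings}$ such that $\pi\bullet Z$ is a solution whenever $Z$ is a solution; subgroups are taken in the group of all permutations of $\mathrm{Bindings}$ under composition. Functional CSP $P_{\mathrm{FCSP}}$: variables are the function and predicate symbols of $\Sigma$; the domain of $f:A_1\times\dots\times A_n\to B$ is the set of all functions $\mathcal U(A_1)\times\dots\times\mathcal U(A_n)\to\mathcal U(B)$, and of $R$ the set of all relations $\subseteq\mathcal U(A_1)\times\dots\times\mathcal U(A_n)$; for each $\phi\in\Gamma$ there is one constraint whose scope is the symbols occurring in $\phi$ and which allows exactly the assignments under which $\phi$ is true. Thus complete assignments are exactly interpretations of $P$. The functional extension $\sigma^{\mathcal F}$ of a domain permutation $\sigma$ is the permutation of $\mathrm{Bindings}(P_{\mathrm{FCSP}})$ mapping $(f,F)$ to $(f,F')$ with $F'(\sigma_{A_1}(a_1),\dots,\sigma_{A_n}(a_n))=\sigma_B(F(a_1,\dots,a_n))$, and $(R,\mathcal R)$ to $(R,\mathcal R')$ with $(a_1,\dots,a_n)\in\mathcal R\iff(\sigma_{A_1}(a_1),\dots,\sigma_{A_n}(a_n))\in\mathcal R'$. -}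

module Defs where

open import Level using (0ℓ)
open import Data.Nat using (ℕ; NonZero)
open import Data.Fin using (Fin)
open import Data.Fin.Permutation using (Permutation′)
open import Data.Bool using (Bool; true)
open import Data.List using (List; []; _∷_; _++_)
open import Data.List.Membership.Propositional using (_∈_)
open import Data.List.Relation.Unary.All as All using (All; []; _∷_)
open import Data.Product using (Σ; Σ-syntax; _×_; _,_; proj₁)
open import Data.Sum using (_⊎_; inj₁; inj₂)
open import Data.Empty using (⊥)
open import Data.Unit using (⊤)
open import Function using (_∘_; _⇔_; Inverse)
open import Relation.Binary using (Setoid)
open import Relation.Binary.PropositionalEquality
  using (_≡_; refl; sym; trans; cong; cong₂; _≗_)
import Function.Construct.Identity as Id
import Function.Construct.Composition as Comp
import Function.Construct.Symmetry as Sym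

record Signature : Set where
  field
    nSorts   : ℕ
    nFun     : ℕ
    nPred    : ℕ
    funArgs  : Fin nFun → List (Fin nSorts)
    funRes   : Fin nFun → Fin nSorts
    predArgs : Fin nPred → List (Fin nSorts)

  Sort : Set
  Sort = Fin nSorts

  FunSym : Set
  FunSym = Fin nFun

  PredSym : Set
  PredSym = Fin nPred

record DomAssign (Sig : Signature) : Set where
  field
    size     : Signature.Sort Sig → ℕ
    nonempty : ∀ θ → NonZero (size θ)

record Constraint (X : Set) (D : X → Setoid 0ℓ 0ℓ) : Set₁ where
  field
    scope  : List X
    -- the allowed tuples, represented as a predicate on complete
    -- assignments (which only inspects the variables in 'scope')
    allows : ((x : X) → Setoid.Carrier (D x)) → Set

record CSP : Set₁ where
  field
    X           : Set
    D           : X → Setoid 0ℓ 0ℓ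
    constraints : List (Constraint X D)

module CSPNotions (P : CSP) where
  open CSP P

  Val : X → Set
  Val x = Setoid.Carrier (D x)

  Binding : Set
  Binding = Σ X Val

  data _≈B_ : Binding → Binding → Set where
    beq : ∀ {x} {v w : Val x} → Setoid._≈_ (D x) v w → (x , v) ≈B (x , w)

  ≈B-refl : ∀ {b} → b ≈B b
  ≈B-refl {x , v} = beq (Setoid.refl (D x))

  ≈B-sym : ∀ {b c} → b ≈B c → c ≈B b
  ≈B-sym (beq {x} p) = beq (Setoid.sym (D x) p)

  ≈B-trans : ∀ {b c d} → b ≈B c → c ≈B d → b ≈B d
  ≈B-trans (beq {x} p) (beq q) = beq (Setoid.trans (D x) p q)

  Bindings : Setoid 0ℓ 0ℓ
  Bindings = record
    { Carrier = Binding
    ; _≈_ = _≈B_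
    ; isEquivalence = record { refl = ≈B-refl ; sym = ≈B-sym ; trans = ≈B-trans } }

  Perm : Set
  Perm = Inverse Bindings Bindings

  idPerm : Perm
  idPerm = Id.inverse Bindings

  -- (π ∘ₚ ρ) b = π (ρ b)
  _∘ₚ_ : Perm → Perm → Perm
  π ∘ₚ ρ = Comp.inverse ρ π

  _⁻¹ₚ : Perm → Perm
  π ⁻¹ₚ = Sym.inverse π

  BSet : Set₁
  BSet = Binding → Set

  _•_ : Perm → BSet → BSet
  (π • Z) b = Σ[ b′ ∈ Binding ] (Z b′ × Inverse.to π b′ ≈B b)

  Assignment : Set
  Assignment = (x : X) → Val x

  IsGraphOf : BSet → Assignment → Set
  IsGraphOf Z α = ∀ b → (Z b ⇔ (Σ[ x ∈ X ] (b ≈B (x , α x))))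

  IsCompleteAssignment : BSet → Set
  IsCompleteAssignment Z = Σ[ α ∈ Assignment ] IsGraphOf Z α

  SatisfiesAll : List (Constraint X D) → Assignment → Set
  SatisfiesAll []       α = ⊤
  SatisfiesAll (c ∷ cs) α = Constraint.allows c α × SatisfiesAll cs α

  Satisfies : Assignment → Set
  Satisfies α = SatisfiesAll constraints α

  IsSolution : BSet → Set
  IsSolution Z = Σ[ α ∈ Assignment ] (IsGraphOf Z α × Satisfies α)

  SolSym : Perm → Set₁
  SolSym π = ∀ (Z : BSet) → IsSolution Z → IsSolution (π • Z)

  IsSubgroupOfSym : (Perm → Set) → Set
  IsSubgroupOfSym H =
    H idPerm
    × (∀ π ρ → H π → H ρ → H (π ∘ₚ ρ))
    × (∀ π → H π → H (π ⁻¹ₚ))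

  IsSubgroupOfSolSym : (Perm → Set) → Set₁
  IsSubgroupOfSolSym H = (∀ π → H π → SolSym π) × IsSubgroupOfSym H

module MSFMF (Sig : Signature) (𝒰 : DomAssign Sig) where
  open Signature Sig public
  open DomAssign 𝒰 public

  U : Sort → Set
  U θ = Fin (size θ)

  Tuple : List Sort → Set
  Tuple as = All U as

  mutual
    data Term (Γ : List Sort) : Sort → Set where
      var : ∀ {A} → A ∈ Γ → Term Γ A
      val : ∀ {A} → U A → Term Γ A
      app : (f : FunSym) → Terms Γ (funArgs f) → Term Γ (funRes f)

    data Terms (Γ : List Sort) : List Sort → Set where
      []  : Terms Γ []
      _∷_ : ∀ {A as} → Term Γ A → Terms Γ as → Terms Γ (A ∷ as)

  data Formula (Γ : List Sort) : Set where
    rel  : (R : PredSym) → Terms Γ (predArgs R) → Formula Γ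
    eq   : ∀ {A} → Term Γ A → Term Γ A → Formula Γ
    ¬f   : Formula Γ → Formula Γ
    _∧f_ : Formula Γ → Formula Γ → Formula Γ
    _∨f_ : Formula Γ → Formula Γ → Formula Γ
    _⇒f_ : Formula Γ → Formula Γ → Formula Γ
    ∀f   : (A : Sort) → Formula (A ∷ Γ) → Formula Γ
    ∃f   : (A : Sort) → Formula (A ∷ Γ) → Formula Γ

  Sentence : Set
  Sentence = Formula []

  record Interp : Set where
    field
      fun  : (f : FunSym)  → Tuple (funArgs f) → U (funRes f)
      pred : (R : PredSym) → Tuple (predArgs R) → Bool
  open Interp public

  Env : List Sort → Set
  Env Γ = Tuple Γ

  mutual
    evalT : ∀ {Γ A} → Interp → Env Γ → Term Γ A → U A
    evalT I ρ (var i)    = All.lookup ρ i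
    evalT I ρ (val a)    = a
    evalT I ρ (app f ts) = fun I f (evalTs I ρ ts)

    evalTs : ∀ {Γ as} → Interp → Env Γ → Terms Γ as → Tuple as
    evalTs I ρ []       = []
    evalTs I ρ (t ∷ ts) = evalT I ρ t ∷ evalTs I ρ ts

  Sat : ∀ {Γ} → Interp → Env Γ → Formula Γ → Set
  Sat I ρ (rel R ts) = pred I R (evalTs I ρ ts) ≡ true
  Sat I ρ (eq s t)   = evalT I ρ s ≡ evalT I ρ t
  Sat I ρ (¬f φ)     = Sat I ρ φ → ⊥
  Sat I ρ (φ ∧f ψ)   = Sat I ρ φ × Sat I ρ ψ
  Sat I ρ (φ ∨f ψ)   = Sat I ρ φ ⊎ Sat I ρ ψ
  Sat I ρ (φ ⇒f ψ)   = Sat I ρ φ → Sat I ρ ψ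
  Sat I ρ (∀f A φ)   = (a : U A) → Sat I (a ∷ ρ) φ
  Sat I ρ (∃f A φ)   = Σ[ a ∈ U A ] Sat I (a ∷ ρ) φ

  _⊨_ : Interp → Sentence → Set
  I ⊨ φ = Sat I [] φ

  _⊨*_ : Interp → List Sentence → Set
  I ⊨* Γ = All (I ⊨_) Γ

  DomPerm : Set
  DomPerm = (θ : Sort) → Permutation′ (size θ)

  mapT : (∀ θ → U θ → U θ) → ∀ {as} → Tuple as → Tuple as
  mapT g = All.map (λ {θ} → g θ)

  -- σ • I :  (σ•I)(f)(σ a⃗) = σ_B (I(f)(a⃗)),  a⃗ ∈ I(R) ⟺ σ a⃗ ∈ (σ•I)(R)
  _•I_ : DomPerm → Interp → Interp
  fun  (σ •I I) f t = Inverse.to (σ (funRes f)) (fun I f (mapT (λ θ → Inverse.from (σ θ)) t))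
  pred (σ •I I) R t = pred I R (mapT (λ θ → Inverse.from (σ θ)) t)

  DomSym : List Sentence → DomPerm → Set
  DomSym Γ σ = ∀ (I : Interp) → ((σ •I I) ⊨* Γ) ⇔ (I ⊨* Γ)

  Var : Set
  Var = FunSym ⊎ PredSym

  argsOf : Var → List Sort
  argsOf (inj₁ f) = funArgs f
  argsOf (inj₂ R) = predArgs R

  codOf : Var → Set
  codOf (inj₁ f) = U (funRes f)
  codOf (inj₂ R) = Bool

  Dom : Var → Setoid 0ℓ 0ℓ
  Dom x = record
    { Carrier = Tuple (argsOf x) → codOf x
    ; _≈_ = _≗_
    ; isEquivalence = record
        { refl = λ _ → refl
        ; sym = λ p t → sym (p t)
        ; trans = λ p q t → trans (p t) (q t) } }

  mutual
    symsT : ∀ {Γ A} → Term Γ A → List Var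
    symsT (var _)    = []
    symsT (val _)    = []
    symsT (app f ts) = inj₁ f ∷ symsTs ts

    symsTs : ∀ {Γ as} → Terms Γ as → List Var
    symsTs []       = []
    symsTs (t ∷ ts) = symsT t ++ symsTs ts

  syms : ∀ {Γ} → Formula Γ → List Var
  syms (rel R ts) = inj₂ R ∷ symsTs ts
  syms (eq s t)   = symsT s ++ symsT t
  syms (¬f φ)     = syms φ
  syms (φ ∧f ψ)   = syms φ ++ syms ψ
  syms (φ ∨f ψ)   = syms φ ++ syms ψ
  syms (φ ⇒f ψ)   = syms φ ++ syms ψ
  syms (∀f A φ)   = syms φ
  syms (∃f A φ)   = syms φ

  toInterp : ((x : Var) → Setoid.Carrier (Dom x)) → Interp
  fun  (toInterp α) f = α (inj₁ f)
  pred (toInterp α) R = α (inj₂ R)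

  constraintOf : Sentence → Constraint Var Dom
  constraintOf φ = record
    { scope  = syms φ
    ; allows = λ α → toInterp α ⊨ φ }

  FCSP : List Sentence → CSP
  FCSP Γ = record { X = Var ; D = Dom ; constraints = Data.List.map constraintOf Γ }
    where import Data.List

  invDP : DomPerm → DomPerm
  invDP σ θ = Sym.inverse (σ θ)

  extVal : DomPerm → (x : Var) → Setoid.Carrier (Dom x) → Setoid.Carrier (Dom x)
  extVal σ (inj₁ f) F t = Inverse.to (σ (funRes f)) (F (mapT (λ θ → Inverse.from (σ θ)) t))
  extVal σ (inj₂ R) ℛ t = ℛ (mapT (λ θ → Inverse.from (σ θ)) t)

  mapT-inv : (σ : DomPerm) → ∀ {as} (t : Tuple as) →
             mapT (λ θ → Inverse.to (σ θ)) (mapT (λ θ → Inverse.from (σ θ)) t) ≡ t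
  mapT-inv σ []             = refl
  mapT-inv σ (_∷_ {θ} a t)  = cong₂ _∷_ (Inverse.inverseˡ (σ θ) refl) (mapT-inv σ t)

  extVal-inv : (σ : DomPerm) → (x : Var) → (v : Setoid.Carrier (Dom x)) →
               Setoid._≈_ (Dom x) (extVal (invDP σ) x (extVal σ x v)) v
  extVal-inv σ (inj₁ f) F t =
    trans (Inverse.inverseʳ (σ (funRes f)) refl) (cong F (mapT-inv (invDP σ) t))
  extVal-inv σ (inj₂ R) ℛ t = cong ℛ (mapT-inv (invDP σ) t)

  extVal-cong : (σ : DomPerm) → (x : Var) → {v w : Setoid.Carrier (Dom x)} →
                Setoid._≈_ (Dom x) v w →
                Setoid._≈_ (Dom x) (extVal σ x v) (extVal σ x w)
  extVal-cong σ (inj₁ f) p t = cong (Inverse.to (σ (funRes f))) (p _)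
  extVal-cong σ (inj₂ R) p t = p _

  invDP-invol : (σ : DomPerm) → (x : Var) → (v : Setoid.Carrier (Dom x)) →
                Setoid._≈_ (Dom x) (extVal σ x (extVal (invDP σ) x v)) v
  invDP-invol σ (inj₁ f) F t =
    trans (Inverse.inverseˡ (σ (funRes f)) refl) (cong F (mapT-inv σ t))
  invDP-invol σ (inj₂ R) ℛ t = cong ℛ (mapT-inv σ t)

  module _ (Γ : List Sentence) where
    open CSPNotions (FCSP Γ)

    extB : DomPerm → Binding → Binding
    extB σ (x , v) = x , extVal σ x v

    extB-cong : ∀ σ {b c} → b ≈B c → extB σ b ≈B extB σ c
    extB-cong σ (beq {x} p) = beq (extVal-cong σ x p)

    _^F : DomPerm → Perm
    σ ^F = record
      { to        = extB σ
      ; from      = extB (invDP σ)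
      ; to-cong   = extB-cong σ
      ; from-cong = extB-cong (invDP σ)
      ; inverse   = invˡ , invʳ }
      where
        invˡ : ∀ {b c} → c ≈B extB (invDP σ) b → extB σ c ≈B b
        invˡ {x , v} p = ≈B-trans (extB-cong σ p) (beq (invDP-invol σ x v))
        invʳ : ∀ {b c} → c ≈B extB σ b → extB (invDP σ) c ≈B b
        invʳ {x , v} p = ≈B-trans (extB-cong (invDP σ) p) (beq (extVal-inv σ x v))

    -- DomSym(P)^F = { σ^F : σ ∈ DomSym(P) }  (permutations equal up to
    -- the equality of the symmetric group, i.e. pointwise on bindings)
    DomSymF : Perm → Set
    DomSymF π = Σ[ σ ∈ DomPerm ] (DomSym Γ σ
                  × (∀ b → Inverse.to π b ≈B Inverse.to (σ ^F) b))

module Submission where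

-- Complete assignments of P_FCSP are interpretations, and under this
-- identification σ^F acts exactly as σ acts on interpretations. Hence for
-- σ ∈ DomSym(P), σ^F preserves satisfaction of Γ and maps solutions to
-- solutions. Closure under identity, composition and inverses holds because
-- σ ↦ σ^F respects these operations up to pointwise equality of functions and
-- relations, and satisfaction depends only on those pointwise values.

open import Defs
open import Data.List using (List; []; _∷_)
import Data.List as List
open import Data.List.Relation.Unary.All as All using ([]; _∷_)
open import Data.List.Relation.Unary.All.Properties using (map-id; map-∘)
open import Data.Product using (Σ-syntax; _,_)
open import Data.Sum using (inj₁; inj₂)
open import Data.Unit using (tt)
open import Function using (_⇔_; Inverse)
open import Function.Bundles using (mk⇔; Equivalence)
open import Function.Construct.Composition using (_⇔-∘_)
open import Function.Construct.Symmetry using (⇔-sym)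
open import Relation.Binary using (Setoid)
open import Relation.Binary.PropositionalEquality
  using (_≡_; refl; sym; trans; cong; cong₂)
import Function.Construct.Identity as Id
import Function.Construct.Composition as Comp

module _ (Sig : Signature) (𝒰 : DomAssign Sig) where
  open MSFMF Sig 𝒰

  Valuation : Set
  Valuation = (x : Var) → Setoid.Carrier (Dom x)

  valuationOf : Interp → Valuation
  valuationOf I (inj₁ f) = fun I f
  valuationOf I (inj₂ R) = pred I R

  _≋_ : Valuation → Valuation → Set
  α ≋ β = ∀ x → Setoid._≈_ (Dom x) (α x) (β x)

  ≋-sym : ∀ {α β} → α ≋ β → β ≋ α
  ≋-sym e x t = sym (e x t)

  mutual
    evalT-cong : ∀ {α β} → α ≋ β → ∀ {Δ A} (ρ : Env Δ) (t : Term Δ A) →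
                 evalT (toInterp α) ρ t ≡ evalT (toInterp β) ρ t
    evalT-cong e ρ (var i)        = refl
    evalT-cong e ρ (val a)        = refl
    evalT-cong {α} e ρ (app f ts) =
      trans (cong (α (inj₁ f)) (evalTs-cong e ρ ts)) (e (inj₁ f) _)

    evalTs-cong : ∀ {α β} → α ≋ β → ∀ {Δ as} (ρ : Env Δ) (ts : Terms Δ as) →
                  evalTs (toInterp α) ρ ts ≡ evalTs (toInterp β) ρ ts
    evalTs-cong e ρ []       = refl
    evalTs-cong e ρ (t ∷ ts) = cong₂ _∷_ (evalT-cong e ρ t) (evalTs-cong e ρ ts)

  Sat-cong : ∀ {α β} → α ≋ β → ∀ {Δ} (ρ : Env Δ) (φ : Formula Δ) →
             Sat (toInterp α) ρ φ → Sat (toInterp β) ρ φ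
  Sat-cong {β = β} e ρ (rel R ts) h =
    trans (cong (β (inj₂ R)) (sym (evalTs-cong e ρ ts))) (trans (sym (e (inj₂ R) _)) h)
  Sat-cong e ρ (eq s t) h       = trans (sym (evalT-cong e ρ s)) (trans h (evalT-cong e ρ t))
  Sat-cong e ρ (¬f φ) h s       = h (Sat-cong (≋-sym e) ρ φ s)
  Sat-cong e ρ (φ ∧f ψ) (a , b) = Sat-cong e ρ φ a , Sat-cong e ρ ψ b
  Sat-cong e ρ (φ ∨f ψ) (inj₁ a) = inj₁ (Sat-cong e ρ φ a)
  Sat-cong e ρ (φ ∨f ψ) (inj₂ b) = inj₂ (Sat-cong e ρ ψ b)
  Sat-cong e ρ (φ ⇒f ψ) h s     = Sat-cong e ρ ψ (h (Sat-cong (≋-sym e) ρ φ s))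
  Sat-cong e ρ (∀f A φ) h a     = Sat-cong e (a ∷ ρ) φ (h a)
  Sat-cong e ρ (∃f A φ) (a , s) = a , Sat-cong e (a ∷ ρ) φ s

  ⊨*-resp-≋ : ∀ {α β} → α ≋ β → (Δ : List Sentence) → toInterp α ⊨* Δ ⇔ toInterp β ⊨* Δ
  ⊨*-resp-≋ e Δ = mk⇔ (All.map (λ {φ} → Sat-cong e [] φ))
                      (All.map (λ {φ} → Sat-cong (≋-sym e) [] φ))

  idDP : DomPerm
  idDP θ = Id.inverse _

  _∘DP_ : DomPerm → DomPerm → DomPerm
  (σ ∘DP τ) θ = Comp.inverse (τ θ) (σ θ)

  extVal-identity : ∀ x v → Setoid._≈_ (Dom x) (extVal idDP x v) v
  extVal-identity (inj₁ f) F t = cong F (map-id t)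
  extVal-identity (inj₂ R) ℛ t = cong ℛ (map-id t)

  extVal-∘ : ∀ σ τ x v →
             Setoid._≈_ (Dom x) (extVal (σ ∘DP τ) x v) (extVal σ x (extVal τ x v))
  extVal-∘ σ τ (inj₁ f) F t =
    cong (λ u → Inverse.to (σ (funRes f)) (Inverse.to (τ (funRes f)) (F u))) (sym (map-∘ t))
  extVal-∘ σ τ (inj₂ R) ℛ t = cong ℛ (sym (map-∘ t))

  -- toInterp (σ •V α) is definitionally σ •I toInterp α.
  _•V_ : DomPerm → Valuation → Valuation
  (σ •V α) x = extVal σ x (α x)

  -- Every interpretation I is definitionally toInterp (valuationOf I), by record η.
  DomSym-fromValuations : ∀ Γ σ →
    (∀ α → toInterp (σ •V α) ⊨* Γ ⇔ toInterp α ⊨* Γ) → DomSym Γ σ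
  DomSym-fromValuations Γ σ h I = h (valuationOf I)

  DomSym-identity : ∀ Γ → DomSym Γ idDP
  DomSym-identity Γ = DomSym-fromValuations Γ idDP λ α →
    ⊨*-resp-≋ (λ x → extVal-identity x (α x)) Γ

  DomSym-∘ : ∀ {Γ} σ τ → DomSym Γ σ → DomSym Γ τ → DomSym Γ (σ ∘DP τ)
  DomSym-∘ {Γ} σ τ Dσ Dτ = DomSym-fromValuations Γ (σ ∘DP τ) λ α →
    Dτ (toInterp α) ⇔-∘ (Dσ (toInterp (τ •V α)) ⇔-∘ ⊨*-resp-≋ (λ x → extVal-∘ σ τ x (α x)) Γ)

  DomSym-inverse : ∀ {Γ} σ → DomSym Γ σ → DomSym Γ (invDP σ)
  DomSym-inverse {Γ} σ Dσ = DomSym-fromValuations Γ (invDP σ) λ α →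
    ⊨*-resp-≋ (λ x → invDP-invol σ x (α x)) Γ ⇔-∘ ⇔-sym (Dσ (toInterp (invDP σ •V α)))

  module _ (Γ : List Sentence) where
    open CSPNotions (FCSP Γ)

    SatisfiesAll⇔⊨* : ∀ Δ α → SatisfiesAll (List.map constraintOf Δ) α ⇔ toInterp α ⊨* Δ
    SatisfiesAll⇔⊨* Δ α = mk⇔ (to Δ) (from Δ)
      where
        to : ∀ Δ → SatisfiesAll (List.map constraintOf Δ) α → toInterp α ⊨* Δ
        to []      _        = []
        to (φ ∷ Δ) (s , ss) = s ∷ to Δ ss
        from : ∀ Δ → toInterp α ⊨* Δ → SatisfiesAll (List.map constraintOf Δ) α
        from []      _        = tt
        from (φ ∷ Δ) (s ∷ ss) = s , from Δ ss

    graph-^F : ∀ π σ {Z α} → (∀ b → Inverse.to π b ≈B Inverse.to (_^F Γ σ) b) →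
               IsGraphOf Z α → IsGraphOf (π • Z) (σ •V α)
    graph-^F π σ {Z} {α} π≈σᶠ G b = mk⇔ image preimage
      where
        image : (π • Z) b → Σ[ x ∈ Var ] (b ≈B (x , (σ •V α) x))
        image (b′ , b′∈Z , πb′≈b) with Equivalence.to (G b′) b′∈Z
        ... | x , b′≈xαx = x , ≈B-trans (≈B-sym πb′≈b) (≈B-trans (π≈σᶠ b′) (extB-cong Γ σ b′≈xαx))
        preimage : Σ[ x ∈ Var ] (b ≈B (x , (σ •V α) x)) → (π • Z) b
        preimage (x , b≈xσαx) =
          (x , α x) , Equivalence.from (G (x , α x)) (x , ≈B-refl) , ≈B-trans (π≈σᶠ _) (≈B-sym b≈xσαx)

    DomSymF⇒SolSym : ∀ π → DomSymF Γ π → SolSym π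
    DomSymF⇒SolSym π (σ , Dσ , π≈σᶠ) Z (α , G , S) =
      σ •V α , graph-^F π σ π≈σᶠ G ,
      Equivalence.from (SatisfiesAll⇔⊨* Γ (σ •V α))
        (Equivalence.from (Dσ (toInterp α)) (Equivalence.to (SatisfiesAll⇔⊨* Γ α) S))

    DomSymF-identity : DomSymF Γ idPerm
    DomSymF-identity = idDP , DomSym-identity Γ , id≈idᶠ
      where
        id≈idᶠ : ∀ b → Inverse.to idPerm b ≈B Inverse.to (_^F Γ idDP) b
        id≈idᶠ (x , v) = beq (λ t → sym (extVal-identity x v t))

    DomSymF-∘ : ∀ π ρ → DomSymF Γ π → DomSymF Γ ρ → DomSymF Γ (π ∘ₚ ρ)
    DomSymF-∘ π ρ (σ , Dσ , π≈σᶠ) (τ , Dτ , ρ≈τᶠ) = σ ∘DP τ , DomSym-∘ σ τ Dσ Dτ , πρ≈[στ]ᶠ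
      where
        πρ≈[στ]ᶠ : ∀ b → Inverse.to (π ∘ₚ ρ) b ≈B Inverse.to (_^F Γ (σ ∘DP τ)) b
        πρ≈[στ]ᶠ (x , v) =
          ≈B-trans (Inverse.to-cong π (ρ≈τᶠ (x , v)))
            (≈B-trans (π≈σᶠ _) (beq (λ t → sym (extVal-∘ σ τ x v t))))

    DomSymF-inverse : ∀ π → DomSymF Γ π → DomSymF Γ (π ⁻¹ₚ)
    DomSymF-inverse π (σ , Dσ , π≈σᶠ) = invDP σ , DomSym-inverse σ Dσ , π⁻¹≈[σ⁻¹]ᶠ
      where
        π⁻¹≈[σ⁻¹]ᶠ : ∀ b → Inverse.to (π ⁻¹ₚ) b ≈B Inverse.to (_^F Γ (invDP σ)) b
        π⁻¹≈[σ⁻¹]ᶠ (x , v) = Inverse.inverseʳ π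
          (≈B-sym (≈B-trans (π≈σᶠ _) (beq (invDP-invol σ x v))))

mainTheorem16 : (Sig : Signature) (𝒰 : DomAssign Sig) (Γ : List (MSFMF.Sentence Sig 𝒰)) →
    CSPNotions.IsSubgroupOfSolSym (MSFMF.FCSP Sig 𝒰 Γ) (MSFMF.DomSymF Sig 𝒰 Γ)
mainTheorem16 Sig 𝒰 Γ =
  DomSymF⇒SolSym Sig 𝒰 Γ ,
  DomSymF-identity Sig 𝒰 Γ ,
  DomSymF-∘ Sig 𝒰 Γ ,
  DomSymF-inverse Sig 𝒰 Γ
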